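{- There is no $3$-uniform Šoltés' hypergraph of order $8$.
   Context: A hypergraph $H=(V,E)$ consists of a finite vertex set $V$ and a set $E$ of distinct subsets of $V$ (hyperedges). $H$ is $k$-uniform if every hyperedge has exactly $k$ elements. The order of $H$ is $|V|$. For $u,w\in V$, the distance $d_H(u,w)$ is the least $\ell\ge 0$ such that there are vertices $u=x_0,\dots,x_\ell=w$ with $x_{i-1},x_i$ contained in a common hyperedge for each $i$ ($\infty$ if none exists); $H$ is connected if all distances are finite. $W(H)=\sum_{\{u,w\}\subseteq V,\,u\ne w} d_H(u,w)$. For $v\in V$, $H\setminus v$ has vertex set $V\setminus\{v\}$ and hyperedge set $\{e\in E: v\notin e\}$. A Šoltés' hypergraph is a connected hypergraph $H$ with $W(H\setminus v)=W(H)$ for every $v\in V$. -}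

module Defs where

open import Data.Nat using (ℕ; zero; suc; _≤_; _<_; _<?_)
open import Data.Nat.ListAction using (sum)
open import Data.Fin using (Fin; toℕ)
open import Data.Fin.Subset using (Subset; _∈_; _∉_; _-_; ⊤; ∣_∣)
open import Data.Fin.Subset.Properties using (_∈?_)
open import Data.List using (List; []; _∷_; allFin; concatMap; filterᵇ)
open import Data.List.Membership.Propositional using () renaming (_∈_ to _∈ₗ_)
open import Data.List.Relation.Unary.Unique.Propositional using (Unique)
open import Data.List.Relation.Unary.All using (All)
open import Data.Product using (Σ; ∃; _×_)
open import Data.Bool using (Bool; true; false; _∧_; if_then_else_)
open import Relation.Nullary using (¬_)
open import Relation.Nullary.Decidable using (⌊_⌋)
open import Relation.Binary.PropositionalEquality using (_≡_)

-- A hypergraph on the vertex set Fin n is given by its list of hyperedges,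
-- each hyperedge a subset of Fin n.  Distinctness of hyperedges is imposed
-- separately (Unique).

Adj : {n : ℕ} → List (Subset n) → Fin n → Fin n → Set
Adj E x y = Σ (Subset _) λ e → (e ∈ₗ E) × (x ∈ e) × (y ∈ e)

data Walk {n : ℕ} (E : List (Subset n)) : ℕ → Fin n → Fin n → Set where
  here : ∀ {u} → Walk E 0 u u
  step : ∀ {ℓ u x w} → Adj E u x → Walk E ℓ x w → Walk E (suc ℓ) u w

IsDist : {n : ℕ} → List (Subset n) → Fin n → Fin n → ℕ → Set
IsDist E u w d = Walk E d u w × (∀ ℓ → Walk E ℓ u w → d ≤ ℓ)

-- sum of D u w over unordered pairs {u,w} ⊆ S with u ≠ w (taken as toℕ u < toℕ w)
sumPairs : {n : ℕ} → Subset n → (Fin n → Fin n → ℕ) → ℕ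
sumPairs {n} S D =
  sum (concatMap (λ u → concatMap (λ w →
         if ⌊ toℕ u <? toℕ w ⌋ ∧ ⌊ u ∈? S ⌋ ∧ ⌊ w ∈? S ⌋
         then D u w ∷ [] else []) (allFin n)) (allFin n))

-- The hypergraph with vertex set S and hyperedge list E is connected and
-- has Wiener index W (all pairwise distances finite, summing to W).
WienerIs : {n : ℕ} → List (Subset n) → Subset n → ℕ → Set
WienerIs {n} E S W =
  Σ (Fin n → Fin n → ℕ) λ D →
    (∀ u w → u ∈ S → w ∈ S → IsDist E u w (D u w)) × (W ≡ sumPairs S D)

deleteVertex : {n : ℕ} → Fin n → List (Subset n) → List (Subset n)
deleteVertex v E = filterᵇ (λ e → if ⌊ v ∈? e ⌋ then false else true) E

-- Šoltés' hypergraph on vertex set Fin n: connected, and W(H \ v) = W(H)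
-- for every vertex v (in particular H \ v is connected, since W(H) is finite).
Soltes : {n : ℕ} → List (Subset n) → Set
Soltes {n} E =
  Σ ℕ λ W → WienerIs E ⊤ W × (∀ (v : Fin n) → WienerIs (deleteVertex v E) (⊤ - v) W)

Uniform : {n : ℕ} → ℕ → List (Subset n) → Set
Uniform k E = Unique E × All (λ e → ∣ e ∣ ≡ k) E

{-# OPTIONS --safe #-}

-- Let H be a 3-uniform Šoltés hypergraph on eight vertices with Wiener index W, and let A be the
-- number of ordered pairs of vertices at distance at least 2 (far pairs). Every ordered pair of
-- distinct vertices contributes at least 1 to 2W and a far pair at least 2, so 56 + A ≤ 2W; and
-- A < 56 because H has an edge.
--
-- Each H - v is a connected 3-uniform hypergraph on seven vertices with Wiener index W. There every
-- edge lies in a triangle, so two consecutive nonempty distance layers around a vertex hold at least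
-- three vertices; a finite check over the possible layer sizes then gives
-- 3·(sum of distances from x) ≤ 18 + 5·(number of vertices far from x), except at deficient
-- vertices (two neighbours, one vertex at distance 2), whose excess is paid for by their neighbours.
-- Summing over x, 6W ≤ 126 + 5·(far pairs of H - v).
--
-- A pair adjacent in H becomes far in H - v only if v is the third vertex of the edge through it,
-- and a far pair of H is far in H - v for at most the six vertices v outside it. Summing over v,
-- 48W ≤ 1008 + 5·(56 + 5A), which together with 56 + A ≤ 2W forces A ≥ 56.

module Submission where

open import Defs
open import Data.Bool using (Bool; true; false; T; T?; if_then_else_; _∧_)
open import Data.Fin using (Fin; toℕ; fromℕ<; punchIn; punchOut)
import Data.Fin as Fin
open import Data.Fin.Properties
  using (toℕ-fromℕ<; toℕ-injective; toℕ<n; any?; injective⇒≤; punchInᵢ≢i; punchIn-injective; punchIn-punchOut)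
open import Data.Fin.Subset using (Subset; _∈_; _∉_; ⊤; _-_; ∣_∣; inside; outside)
open import Data.Fin.Subset.Properties using (_∈?_; ∈⊤; x∈p∧x≢y⇒x∈p-y)
open import Data.List using (List; []; _∷_; length; map; concatMap; upTo; allFin)
import Data.List as List
open import Data.List.Membership.Propositional using () renaming (_∈_ to _∈ₗ_)
open import Data.List.Membership.Propositional.Properties
  using (∈-concat⁺′; ∈-map⁺; ∈-upTo⁺; ∈-filter⁺; ∈-filter⁻)
open import Data.List.Relation.Unary.All using (All; []; _∷_; all?)
import Data.List.Relation.Unary.All as All
open import Data.List.Relation.Unary.AllPairs using ([]; _∷_)
import Data.List.Relation.Unary.Any as Any
open import Data.List.Relation.Unary.Unique.Propositional using (Unique)
open import Data.Nat using (ℕ; zero; suc; _+_; _*_; _∸_; _≤_; _<_; z≤n; s≤s; _≟_; _≤?_; _<?_)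
open import Data.Nat.ListAction using () renaming (sum to sumₗ)
open import Data.Nat.ListAction.Properties using (sum-++)
open import Data.Nat.Properties
open import Data.Nat.Solver using (module +-*-Solver)
open import Data.Product using (∃; ∃-syntax; _×_; _,_; proj₁; proj₂)
open import Data.Sum using (_⊎_; inj₁; inj₂)
open import Data.Vec using (Vec; []; _∷_; there; tabulate; lookup)
import Data.Vec as Vec
open import Data.Vec.Properties using (lookup∘tabulate)
open import Function using (id; _∘_; case_of_)
open import Function.Metric.Nat using (IsMetric)
open import Level using (0ℓ)
open import Relation.Nullary using (¬_; Dec; yes; no; does; ¬?; contradiction)
open import Relation.Nullary.Decidable
  using (⌊_⌋; _×-dec_; _⊎-dec_; _→-dec_; toWitness; decidable-stable; dec-true; dec-false)
open import Relation.Unary using (Pred; Decidable; _⊆_)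
open import Relation.Binary.PropositionalEquality
open import Algebra.Properties.Semiring.Sum +-*-semiring
  using (sum; sum-syntax; ∑-distrib-+; ∑-comm; sum-cong-≗; *-distribˡ-sum; *-distribʳ-sum; sum-remove; sum-replicate-zero)

private variable
  n a b k : ℕ
  A B : Set
  E : List (Subset n)
  u w x y z : Fin n

-- Finite sums and counting

𝟙 : Dec A → ℕ
𝟙 a? = if does a? then 1 else 0

𝟙-yes : (a? : Dec A) → A → 𝟙 a? ≡ 1
𝟙-yes (yes _) _ = refl
𝟙-yes (no ¬a) a = contradiction a ¬a

𝟙-no : (a? : Dec A) → ¬ A → 𝟙 a? ≡ 0
𝟙-no (yes a) ¬a = contradiction a ¬a
𝟙-no (no _)  _  = refl

𝟙-mono : (a? : Dec A) (b? : Dec B) → (A → B) → 𝟙 a? ≤ 𝟙 b?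
𝟙-mono (yes a) b? f = ≤-reflexive (sym (𝟙-yes b? (f a)))
𝟙-mono (no _)  _  _ = z≤n

𝟙-× : (a? : Dec A) (b? : Dec B) → 𝟙 (a? ×-dec b?) ≡ 𝟙 a? * 𝟙 b?
𝟙-× (yes _) (yes _) = refl
𝟙-× (yes _) (no _)  = refl
𝟙-× (no _)  _       = refl

𝟙-¬ : (a? : Dec A) → 𝟙 a? + 𝟙 (¬? a?) ≡ 1
𝟙-¬ (yes _) = refl
𝟙-¬ (no _)  = refl

∑-mono-≤ : {f g : Fin n → ℕ} → (∀ i → f i ≤ g i) → ∑[ i < n ] f i ≤ ∑[ i < n ] g i
∑-mono-≤ {zero}  _   = z≤n
∑-mono-≤ {suc n} f≤g = +-mono-≤ (f≤g _) (∑-mono-≤ (f≤g ∘ Fin.suc))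

∑-mono-< : {f g : Fin n → ℕ} → (∀ i → f i ≤ g i) → ∀ j → f j < g j → ∑[ i < n ] f i < ∑[ i < n ] g i
∑-mono-< {suc n} {f} {g} f≤g j fj<gj = begin-strict
  sum f                             ≡⟨ sum-remove {i = j} f ⟩
  f j + ∑[ i < n ] f (punchIn j i)  <⟨ +-mono-<-≤ fj<gj (∑-mono-≤ (f≤g ∘ punchIn j)) ⟩
  g j + ∑[ i < n ] g (punchIn j i)  ≡⟨ sum-remove {i = j} g ⟨
  sum g                             ∎
  where open ≤-Reasoning

∑-+-* : (f g : Fin n → ℕ) (c : ℕ) → ∑[ i < n ] (f i + c * g i) ≡ ∑[ i < n ] f i + c * ∑[ i < n ] g i
∑-+-* {n} f g c = trans (∑-distrib-+ {n} f (λ i → c * g i)) (cong (sum f +_) (sym (*-distribˡ-sum {n} c g)))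

∑-const : (c : ℕ) → ∑[ i < n ] c ≡ n * c
∑-const {zero}  c = refl
∑-const {suc n} c = cong (c +_) (∑-const {n} c)

∑-pick : (f : Fin n → ℕ) (i : Fin n) → (∀ j → j ≢ i → f j ≡ 0) → ∑[ j < n ] f j ≡ f i
∑-pick {suc n} f i off-i = begin
  sum f                             ≡⟨ sum-remove {i = i} f ⟩
  f i + ∑[ j < n ] f (punchIn i j)  ≡⟨ cong (f i +_) (sum-cong-≗ {n} (λ j → off-i _ (punchInᵢ≢i i j))) ⟩
  f i + ∑[ j < n ] 0                ≡⟨ cong (f i +_) (sum-replicate-zero n) ⟩
  f i + 0                           ≡⟨ +-identityʳ (f i) ⟩
  f i                               ∎
  where open ≡-Reasoning

count : {P : Pred (Fin n) 0ℓ} → Decidable P → ℕ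
count {n} P? = ∑[ i < n ] 𝟙 (P? i)

module _ {P : Pred (Fin n) 0ℓ} (P? : Decidable P) where

  count-none : (∀ i → ¬ P i) → count P? ≡ 0
  count-none ∄ = trans (sum-cong-≗ {n} (λ i → 𝟙-no (P? i) (∄ i))) (sum-replicate-zero n)

  count-witness : 0 < count P? → ∃ P
  count-witness 0<count with any? P?
  ... | yes found = found
  ... | no ∄ = contradiction (count-none (λ i p → ∄ (i , p))) (>⇒≢ 0<count)

  count-mono : {Q : Pred (Fin n) 0ℓ} (Q? : Decidable Q) → P ⊆ Q → count P? ≤ count Q?
  count-mono Q? P⊆Q = ∑-mono-≤ (λ i → 𝟙-mono (P? i) (Q? i) P⊆Q)

  count-complement : count P? + count (¬? ∘ P?) ≡ n
  count-complement = begin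
    count P? + count (¬? ∘ P?)             ≡⟨ ∑-distrib-+ {n} (𝟙 ∘ P?) (𝟙 ∘ ¬? ∘ P?) ⟨
    ∑[ i < n ] (𝟙 (P? i) + 𝟙 (¬? (P? i)))  ≡⟨ sum-cong-≗ {n} (𝟙-¬ ∘ P?) ⟩
    ∑[ i < n ] 1                           ≡⟨ ∑-const {n} 1 ⟩
    n * 1                                  ≡⟨ *-identityʳ n ⟩
    n                                      ∎
    where open ≡-Reasoning

  count-split : {Q : Pred (Fin n) 0ℓ} (Q? : Decidable Q) →
                count P? ≡ count (λ i → P? i ×-dec Q? i) + count (λ i → P? i ×-dec ¬? (Q? i))
  count-split Q? = trans (sum-cong-≗ {n} (λ i → split (P? i) (Q? i))) (∑-distrib-+ {n} _ _)
    where
    split : (a? : Dec A) (b? : Dec B) → 𝟙 a? ≡ 𝟙 (a? ×-dec b?) + 𝟙 (a? ×-dec ¬? b?)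
    split (yes _) (yes _) = refl
    split (yes _) (no _)  = refl
    split (no _)  _       = refl

count-≡ : (a : Fin n) → count (Fin._≟ a) ≡ 1
count-≡ a = trans (∑-pick (λ i → 𝟙 (i Fin.≟ a)) a (λ i i≢a → 𝟙-no (i Fin.≟ a) i≢a))
                  (𝟙-yes (a Fin.≟ a) refl)

count≤length : {P : Pred (Fin n) 0ℓ} (P? : Decidable P) (xs : List (Fin n)) →
               (∀ {i} → P i → i ∈ₗ xs) → count P? ≤ length xs
count≤length P? [] P⊆[] = ≤-reflexive (count-none P? (λ i p → case P⊆[] {i} p of λ ()))
count≤length {P = P} P? (x ∷ xs) P⊆x∷xs = begin
  count P?                                     ≡⟨ count-split P? (Fin._≟ x) ⟩
  count at-x + count off-x                     ≤⟨ +-mono-≤ (count-mono at-x (Fin._≟ x) proj₂)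
                                                           (count≤length off-x xs off-x⊆xs) ⟩
  count (Fin._≟ x) + length xs                 ≡⟨ cong (_+ length xs) (count-≡ x) ⟩
  suc (length xs)                              ∎
  where
  open ≤-Reasoning
  at-x : Decidable (λ i → P i × i ≡ x)
  at-x i = P? i ×-dec i Fin.≟ x
  off-x : Decidable (λ i → P i × i ≢ x)
  off-x i = P? i ×-dec ¬? (i Fin.≟ x)
  off-x⊆xs : ∀ {i} → P i × i ≢ x → i ∈ₗ xs
  off-x⊆xs (p , i≢x) with P⊆x∷xs p
  ... | Any.here i≡x = contradiction i≡x i≢x
  ... | Any.there i∈xs = i∈xs

length≤count : {P : Pred (Fin n) 0ℓ} (P? : Decidable P) {xs : List (Fin n)} →
               Unique xs → All P xs → length xs ≤ count P?
length≤count P? [] [] = z≤n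
length≤count {P = P} P? {x ∷ xs} (x∉xs ∷ unique) (px ∷ pxs) = begin
  suc (length xs)                              ≡⟨ cong (_+ length xs) (count-≡ x) ⟨
  count (Fin._≟ x) + length xs                 ≤⟨ +-mono-≤ (count-mono (Fin._≟ x) at-x λ { refl → px , refl })
                                                           (length≤count off-x unique off-x-xs) ⟩
  count at-x + count off-x                     ≡⟨ count-split P? (Fin._≟ x) ⟨
  count P?                                     ∎
  where
  open ≤-Reasoning
  at-x : Decidable (λ i → P i × i ≡ x)
  at-x i = P? i ×-dec i Fin.≟ x
  off-x : Decidable (λ i → P i × i ≢ x)
  off-x i = P? i ×-dec ¬? (i Fin.≟ x)
  off-x-xs : All (λ i → P i × i ≢ x) xs
  off-x-xs = All.zipWith (λ (p , x≢i) → p , ≢-sym x≢i) (pxs , x∉xs)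

length<count⇒∃∉ : {P : Pred (Fin n) 0ℓ} (P? : Decidable P) (xs : List (Fin n)) →
                  length xs < count P? → ∃ λ i → P i × ¬ i ∈ₗ xs
length<count⇒∃∉ {P = P} P? xs xs<count with any? (λ i → P? i ×-dec ¬? (Any.any? (i Fin.≟_) xs))
... | yes found = found
... | no none = contradiction (count≤length P? xs P⊆xs) (<⇒≱ xs<count)
  where
  P⊆xs : ∀ {i} → P i → i ∈ₗ xs
  P⊆xs {i} p = decidable-stable (Any.any? (i Fin.≟_) xs) (λ i∉xs → none (i , p , i∉xs))

count≤1 : {P : Pred (Fin n) 0ℓ} (P? : Decidable P) → (∀ {i j} → P i → P j → i ≡ j) → count P? ≤ 1
count≤1 P? unique with any? P?
... | yes (i , p) = count≤length P? (i ∷ []) (λ q → Any.here (unique q p))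
... | no none = ≤-trans (≤-reflexive (count-none P? (λ i p → none (i , p)))) z≤n

∑-fibres : {m : ℕ} (f : Fin n → ℕ) (g : ℕ → ℕ) → (∀ i → f i < m) →
           ∑[ i < n ] g (f i) ≡ ∑[ k < m ] (g (toℕ k) * count (λ i → f i ≟ toℕ k))
∑-fibres {n} {m} f g f<m = begin
  ∑[ i < n ] g (f i)
    ≡⟨ sum-cong-≗ {n} (λ i → fibre (f i) (f<m i)) ⟨
  ∑[ i < n ] ∑[ k < m ] (g (toℕ k) * 𝟙 (f i ≟ toℕ k))
    ≡⟨ ∑-comm {n} {m} (λ i k → g (toℕ k) * 𝟙 (f i ≟ toℕ k)) ⟩
  ∑[ k < m ] ∑[ i < n ] (g (toℕ k) * 𝟙 (f i ≟ toℕ k))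
    ≡⟨ sum-cong-≗ {m} (λ k → *-distribˡ-sum {n} (g (toℕ k)) (λ i → 𝟙 (f i ≟ toℕ k))) ⟨
  ∑[ k < m ] (g (toℕ k) * count (λ i → f i ≟ toℕ k))
    ∎
  where
  open ≡-Reasoning
  fibre : ∀ a → a < m → ∑[ k < m ] (g (toℕ k) * 𝟙 (a ≟ toℕ k)) ≡ g a
  fibre a a<m = begin
    ∑[ k < m ] (g (toℕ k) * 𝟙 (a ≟ toℕ k))  ≡⟨ ∑-pick _ k₀ off-k₀ ⟩
    g (toℕ k₀) * 𝟙 (a ≟ toℕ k₀)             ≡⟨ cong (λ b → g b * 𝟙 (a ≟ b)) (toℕ-fromℕ< a<m) ⟩
    g a * 𝟙 (a ≟ a)                         ≡⟨ cong (g a *_) (𝟙-yes (a ≟ a) refl) ⟩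
    g a * 1                                 ≡⟨ *-identityʳ (g a) ⟩
    g a                                     ∎
    where
    k₀ : Fin m
    k₀ = fromℕ< a<m
    off-k₀ : ∀ k → k ≢ k₀ → g (toℕ k) * 𝟙 (a ≟ toℕ k) ≡ 0
    off-k₀ k k≢k₀ = trans (cong (g (toℕ k) *_) (𝟙-no (a ≟ toℕ k) a≢k)) (*-zeroʳ (g (toℕ k)))
      where
      a≢k : a ≢ toℕ k
      a≢k a≡k = k≢k₀ (toℕ-injective (trans (sym a≡k) (sym (toℕ-fromℕ< a<m))))

compositions : ℕ → (k : ℕ) → List (Vec ℕ k)
compositions n (suc k) = concatMap (λ a → map (a ∷_) (compositions (n ∸ a) k)) (upTo (suc n))
compositions zero    zero = [] ∷ []
compositions (suc _) zero = []

∈-compositions : (v : Vec ℕ k) → v ∈ₗ compositions (Vec.sum v) k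
∈-compositions [] = Any.here refl
∈-compositions {suc k} (a ∷ v) =
  ∈-concat⁺′ (∈-map⁺ (a ∷_) v∈) (∈-map⁺ first-part (∈-upTo⁺ (s≤s (m≤m+n a (Vec.sum v)))))
  where
  first-part : ℕ → List (Vec ℕ (suc k))
  first-part b = map (b ∷_) (compositions (a + Vec.sum v ∸ b) k)
  v∈ : v ∈ₗ compositions (a + Vec.sum v ∸ a) k
  v∈ = subst (λ m → v ∈ₗ compositions m k) (sym (m+n∸m≡n a (Vec.sum v))) (∈-compositions v)

all-compositions : {P : Pred (Vec ℕ k) 0ℓ} → All P (compositions n k) → ∀ v → Vec.sum v ≡ n → P v
all-compositions all-P v refl = All.lookup all-P (∈-compositions v)

-- Subsets and sums over pairs

x∈p-y⇒x≢y : {p : Subset n} → x ∈ p - y → x ≢ y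
x∈p-y⇒x≢y {x = Fin.zero}  {p = _ ∷ _} () refl
x∈p-y⇒x≢y {x = Fin.suc x} {p = _ ∷ _} (there x∈p-x) refl = x∈p-y⇒x≢y x∈p-x refl

∣p∣≡count∈ : (p : Subset n) → ∣ p ∣ ≡ count (_∈? p)
∣p∣≡count∈ []            = refl
∣p∣≡count∈ (inside ∷ p)  = cong suc (∣p∣≡count∈ p)
∣p∣≡count∈ (outside ∷ p) = ∣p∣≡count∈ p

module _ {e : Subset n} (∣e∣≡3 : ∣ e ∣ ≡ 3) where

  private
    count∈e≡3 : count (_∈? e) ≡ 3
    count∈e≡3 = trans (sym (∣p∣≡count∈ e)) ∣e∣≡3

  third-vertex : ∀ a b → ∃[ t ] t ∈ e × t ≢ a × t ≢ b
  third-vertex a b with length<count⇒∃∉ (_∈? e) (a ∷ b ∷ []) (≤-reflexive (sym count∈e≡3))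
  ... | t , t∈e , t∉ab = t , t∈e , t∉ab ∘ Any.here , t∉ab ∘ Any.there ∘ Any.here

  third-vertex-unique : ∀ {a b t t′} → a ∈ e → b ∈ e → a ≢ b →
                        t ∈ e × t ≢ a × t ≢ b → t′ ∈ e × t′ ≢ a × t′ ≢ b → t ≡ t′
  third-vertex-unique {a} {b} {t} {t′} a∈e b∈e a≢b (t∈e , t≢a , t≢b) (t′∈e , t′≢a , t′≢b) with t Fin.≟ t′
  ... | yes t≡t′ = t≡t′
  ... | no t≢t′ = contradiction (length≤count (_∈? e) distinct (a∈e ∷ b∈e ∷ t∈e ∷ t′∈e ∷ []))
                                (<⇒≱ (≤-reflexive (cong suc count∈e≡3)))
    where
    distinct : Unique (a ∷ b ∷ t ∷ t′ ∷ [])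
    distinct = (a≢b ∷ ≢-sym t≢a ∷ ≢-sym t′≢a ∷ [])
             ∷ (≢-sym t≢b ∷ ≢-sym t′≢b ∷ [])
             ∷ (t≢t′ ∷ [])
             ∷ []
             ∷ []

sumIn : Subset n → (Fin n → ℕ) → ℕ
sumIn {n} S f = ∑[ u < n ] (if does (u ∈? S) then f u else 0)

sumIn-⊤ : (f : Fin n → ℕ) → sumIn ⊤ f ≡ ∑[ u < n ] f u
sumIn-⊤ {n} f = sum-cong-≗ {n} (λ u → cong (if_then f u else 0) (dec-true (u ∈? ⊤) ∈⊤))

sumIn-⊤- : (v : Fin (suc n)) (f : Fin (suc n) → ℕ) → sumIn (⊤ - v) f ≡ ∑[ i < n ] f (punchIn v i)
sumIn-⊤- {n} v f = begin
  sumIn (⊤ - v) f                                 ≡⟨ sum-remove {i = v} restricted ⟩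
  restricted v + ∑[ i < n ] restricted (punchIn v i)
    ≡⟨ cong₂ _+_ (cong (if_then f v else 0) (dec-false (v ∈? ⊤ - v) (λ v∈ → x∈p-y⇒x≢y v∈ refl)))
                 (sum-cong-≗ {n} (λ i → cong (if_then f (punchIn v i) else 0)
                                             (dec-true (punchIn v i ∈? ⊤ - v) (x∈p∧x≢y⇒x∈p-y ∈⊤ (punchInᵢ≢i v i))))) ⟩
  ∑[ i < n ] f (punchIn v i)                      ∎
  where
  open ≡-Reasoning
  restricted : Fin (suc n) → ℕ
  restricted u = if does (u ∈? ⊤ - v) then f u else 0

sumIn-⊤-² : (v : Fin (suc n)) (f : Fin (suc n) → Fin (suc n) → ℕ) →
            sumIn (⊤ - v) (λ u → sumIn (⊤ - v) (f u)) ≡ ∑[ i < n ] ∑[ j < n ] f (punchIn v i) (punchIn v j)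
sumIn-⊤-² {n} v f =
  trans (sumIn-⊤- v (λ u → sumIn (⊤ - v) (f u))) (sum-cong-≗ {n} (λ i → sumIn-⊤- v (f (punchIn v i))))

private
  if-∑ : (b : Bool) (g : Fin n → ℕ) → (if b then ∑[ i < n ] g i else 0) ≡ ∑[ i < n ] (if b then g i else 0)
  if-∑ true g = refl
  if-∑ {n} false g = sym (sum-replicate-zero n)

  sumₗ-concatMap : (g : Fin n → A) (f : A → List ℕ) →
                   sumₗ (concatMap f (List.tabulate g)) ≡ ∑[ i < n ] sumₗ (f (g i))
  sumₗ-concatMap {zero} g f = refl
  sumₗ-concatMap {suc n} g f =
    trans (sum-++ (f (g Fin.zero)) _) (cong (sumₗ (f (g Fin.zero)) +_) (sumₗ-concatMap (g ∘ Fin.suc) f))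

  sumₗ-if : (b : Bool) (x : ℕ) → sumₗ (if b then x ∷ [] else []) ≡ (if b then x else 0)
  sumₗ-if true x = +-identityʳ x
  sumₗ-if false x = refl

sumIn² : (S : Subset n) (f : Fin n → Fin n → ℕ) →
         sumIn S (λ u → sumIn S (f u)) ≡
         ∑[ u < n ] ∑[ w < n ] (if does (u ∈? S) then (if does (w ∈? S) then f u w else 0) else 0)
sumIn² {n} S f = sum-cong-≗ {n} (λ u → if-∑ (does (u ∈? S)) (λ w → if does (w ∈? S) then f u w else 0))

module _ (S : Subset n) (D : Fin n → Fin n → ℕ) where

  private
    below : Fin n → Fin n → ℕ
    below u w = if ⌊ toℕ u <? toℕ w ⌋ ∧ ⌊ u ∈? S ⌋ ∧ ⌊ w ∈? S ⌋ then D u w else 0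

    sumPairs≡∑∑below : sumPairs S D ≡ ∑[ u < n ] ∑[ w < n ] below u w
    sumPairs≡∑∑below =
      trans (sumₗ-concatMap id row)
            (sum-cong-≗ {n} (λ u → trans (sumₗ-concatMap id (entry u)) (sum-cong-≗ {n} (λ w → sumₗ-if _ (D u w)))))
      where
      entry : Fin n → Fin n → List ℕ
      entry u w = if ⌊ toℕ u <? toℕ w ⌋ ∧ ⌊ u ∈? S ⌋ ∧ ⌊ w ∈? S ⌋ then D u w ∷ [] else []
      row : Fin n → List ℕ
      row u = concatMap (entry u) (allFin n)

  sumIn²≡2*sumPairs : (∀ u w → u ∈ S → w ∈ S → D u w ≡ D w u) → (∀ u → u ∈ S → D u u ≡ 0) →
                      sumIn S (λ u → sumIn S (D u)) ≡ 2 * sumPairs S D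
  sumIn²≡2*sumPairs D-sym D-diag = begin
    sumIn S (λ u → sumIn S (D u))
      ≡⟨ sumIn² S D ⟩
    ∑[ u < n ] ∑[ w < n ] restricted u w
      ≡⟨ sum-cong-≗ {n} (λ u → sum-cong-≗ {n} (split u)) ⟩
    ∑[ u < n ] ∑[ w < n ] (below u w + below w u)
      ≡⟨ sum-cong-≗ {n} (λ u → ∑-distrib-+ {n} (below u) (λ w → below w u)) ⟩
    ∑[ u < n ] (∑[ w < n ] below u w + ∑[ w < n ] below w u)
      ≡⟨ ∑-distrib-+ {n} (λ u → ∑[ w < n ] below u w) (λ u → ∑[ w < n ] below w u) ⟩
    P + ∑[ u < n ] ∑[ w < n ] below w u
      ≡⟨ cong (P +_) (∑-comm {n} {n} (λ u w → below w u)) ⟩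
    P + P
      ≡⟨ cong (P +_) (sym (+-identityʳ P)) ⟩
    2 * P
      ≡⟨ cong (2 *_) sumPairs≡∑∑below ⟨
    2 * sumPairs S D
      ∎
    where
    open ≡-Reasoning
    P : ℕ
    P = ∑[ u < n ] ∑[ w < n ] below u w
    restricted : Fin n → Fin n → ℕ
    restricted u w = if does (u ∈? S) then (if does (w ∈? S) then D u w else 0) else 0
    split : ∀ u w → restricted u w ≡ below u w + below w u
    split u w with toℕ u <? toℕ w | toℕ w <? toℕ u | u ∈? S | w ∈? S
    ... | yes u<w | yes w<u | _      | _      = contradiction w<u (<-asym u<w)
    ... | yes _   | no _    | yes _  | yes _  = sym (+-identityʳ _)
    ... | yes _   | no _    | yes _  | no _   = refl
    ... | yes _   | no _    | no _   | yes _  = refl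
    ... | yes _   | no _    | no _   | no _   = refl
    ... | no _    | yes _   | yes u∈ | yes w∈ = D-sym u w u∈ w∈
    ... | no _    | yes _   | yes _  | no _   = refl
    ... | no _    | yes _   | no _   | yes _  = refl
    ... | no _    | yes _   | no _   | no _   = refl
    ... | no _    | no _    | yes _  | no _   = refl
    ... | no _    | no _    | no _   | yes _  = refl
    ... | no _    | no _    | no _   | no _   = refl
    ... | no u≮w  | no w≮u  | yes u∈ | yes _  with toℕ-injective (≤-antisym (≮⇒≥ w≮u) (≮⇒≥ u≮w))
    ...   | refl = D-diag u u∈

-- Distances in hypergraphs

adj-sym : Adj E x y → Adj E y x
adj-sym (e , e∈E , x∈e , y∈e) = e , e∈E , y∈e , x∈e

walk-++ : Walk E a x y → Walk E b y z → Walk E (a + b) x z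
walk-++ here        q = q
walk-++ (step xy p) q = step xy (walk-++ p q)

walk-reverse : Walk E a x y → Walk E a y x
walk-reverse here = here
walk-reverse {E = E} {a = suc a} {x} {y} (step xz p) =
  subst (λ l → Walk E l y x) (+-comm a 1) (walk-++ (walk-reverse p) (step (adj-sym xz) here))

walk-0 : Walk E 0 x y → x ≡ y
walk-0 here = refl

walk-1 : Walk E 1 x y → Adj E x y
walk-1 (step xy here) = xy

module Distances {E : List (Subset n)} {S : Subset n} {D : Fin n → Fin n → ℕ}
                 (isDist : ∀ u w → u ∈ S → w ∈ S → IsDist E u w (D u w)) where

  private
    walk : u ∈ S → w ∈ S → Walk E (D u w) u w
    walk u∈S w∈S = proj₁ (isDist _ _ u∈S w∈S)

    shortest : u ∈ S → w ∈ S → Walk E k u w → D u w ≤ k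
    shortest u∈S w∈S = proj₂ (isDist _ _ u∈S w∈S) _

  D-self : u ∈ S → D u u ≡ 0
  D-self u∈S = n≤0⇒n≡0 (shortest u∈S u∈S here)

  D≡0⇒≡ : u ∈ S → w ∈ S → D u w ≡ 0 → u ≡ w
  D≡0⇒≡ u∈S w∈S D≡0 = walk-0 (subst (λ l → Walk E l _ _) D≡0 (walk u∈S w∈S))

  ≢⇒1≤D : u ∈ S → w ∈ S → u ≢ w → 1 ≤ D u w
  ≢⇒1≤D u∈S w∈S u≢w = n≢0⇒n>0 (u≢w ∘ D≡0⇒≡ u∈S w∈S)

  ¬2≤D-self : u ∈ S → ¬ 2 ≤ D u u
  ¬2≤D-self u∈S 2≤ = contradiction (subst (2 ≤_) (D-self u∈S) 2≤) λ ()

  D-sym : u ∈ S → w ∈ S → D u w ≡ D w u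
  D-sym u∈S w∈S = ≤-antisym (shortest u∈S w∈S (walk-reverse (walk w∈S u∈S)))
                            (shortest w∈S u∈S (walk-reverse (walk u∈S w∈S)))

  D-triangle : u ∈ S → w ∈ S → z ∈ S → D u z ≤ D u w + D w z
  D-triangle u∈S w∈S z∈S = shortest u∈S z∈S (walk-++ (walk u∈S w∈S) (walk w∈S z∈S))

  adj⇒D≤1 : u ∈ S → w ∈ S → Adj E u w → D u w ≤ 1
  adj⇒D≤1 u∈S w∈S uw = shortest u∈S w∈S (step uw here)

  adj⇒D≡1 : u ∈ S → w ∈ S → Adj E u w → u ≢ w → D u w ≡ 1
  adj⇒D≡1 u∈S w∈S uw u≢w = ≤-antisym (adj⇒D≤1 u∈S w∈S uw) (≢⇒1≤D u∈S w∈S u≢w)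

  D≡1⇒adj : u ∈ S → w ∈ S → D u w ≡ 1 → Adj E u w
  D≡1⇒adj u∈S w∈S D≡1 = walk-1 (subst (λ l → Walk E l _ _) D≡1 (walk u∈S w∈S))

  D-step : (∀ {x y} → Adj E x y → y ∈ S) → u ∈ S → w ∈ S → D u w ≡ suc k →
           ∃[ z ] z ∈ S × Adj E u z × D u z ≡ 1 × D z w ≡ k
  D-step {u = u} {w = w} {k = k} closed u∈S w∈S D≡1+k =
    first-step (subst (λ l → Walk E l u w) D≡1+k (walk u∈S w∈S))
    where
    first-step : Walk E (suc k) u w → ∃[ z ] z ∈ S × Adj E u z × D u z ≡ 1 × D z w ≡ k
    first-step (step {x = z} uz zw) = z , z∈S , uz , adj⇒D≡1 u∈S z∈S uz u≢z , ≤-antisym D≤k k≤D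
      where
      z∈S : z ∈ S
      z∈S = closed uz
      D≤k : D z w ≤ k
      D≤k = shortest z∈S w∈S zw
      k≤D : k ≤ D z w
      k≤D = ≤-pred (begin
        suc k          ≡⟨ D≡1+k ⟨
        D u w          ≤⟨ D-triangle u∈S z∈S w∈S ⟩
        D u z + D z w  ≤⟨ +-monoˡ-≤ (D z w) (adj⇒D≤1 u∈S z∈S uz) ⟩
        suc (D z w)    ∎)
        where open ≤-Reasoning
      u≢z : u ≢ z
      u≢z refl = 1+n≰n (≤-trans (≤-reflexive (sym D≡1+k)) D≤k)

private
  misses : Fin n → Subset n → Bool
  misses v e = if ⌊ v ∈? e ⌋ then false else true

∈-deleteVertex⁻ : ∀ {v} {e : Subset n} E → e ∈ₗ deleteVertex v E → e ∈ₗ E × v ∉ e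
∈-deleteVertex⁻ {v = v} {e} E e∈ with ∈-filter⁻ (T? ∘ misses v) {xs = E} e∈
... | e∈E , kept with v ∈? e
...   | no v∉e = e∈E , v∉e

∈-deleteVertex⁺ : ∀ {v} {e : Subset n} E → e ∈ₗ E → v ∉ e → e ∈ₗ deleteVertex v E
∈-deleteVertex⁺ {v = v} {e} E e∈E v∉e = ∈-filter⁺ (T? ∘ misses v) e∈E kept
  where
  kept : T (misses v e)
  kept with v ∈? e
  ... | yes v∈e = v∉e v∈e
  ... | no _ = _

record TriangulatedPathMetric (n : ℕ) : Set where
  field
    dist             : Fin n → Fin n → ℕ
    isMetric         : IsMetric _≡_ dist
    step-toward      : ∀ {x y k} → dist x y ≡ suc k → ∃[ z ] dist x z ≡ 1 × dist z y ≡ k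
    edge-in-triangle : ∀ {x y} → dist x y ≡ 1 → ∃[ t ] t ≢ x × t ≢ y × dist x t ≡ 1 × dist y t ≡ 1

  open IsMetric isMetric public
    using () renaming (sym to dist-sym; triangle to dist-triangle; 0⇒≈ to dist≡0⇒≡; ≈⇒0 to ≡⇒dist≡0)

module _ {n} {E : List (Subset (suc n))} (uniform : All (λ e → ∣ e ∣ ≡ 3) E) (v : Fin (suc n))
         {D : Fin (suc n) → Fin (suc n) → ℕ}
         (isDist : ∀ u w → u ∈ ⊤ - v → w ∈ ⊤ - v → IsDist (deleteVertex v E) u w (D u w)) where

  open Distances isDist

  private
    ≢⇒∈ : ∀ {x} → x ≢ v → x ∈ ⊤ - v
    ≢⇒∈ = x∈p∧x≢y⇒x∈p-y ∈⊤

    ↑ : Fin n → Fin (suc n)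
    ↑ = punchIn v

    ↑∈ : ∀ i → ↑ i ∈ ⊤ - v
    ↑∈ i = ≢⇒∈ (punchInᵢ≢i v i)

    ↑-onto : ∀ {x} → x ∈ ⊤ - v → ∃[ i ] ↑ i ≡ x
    ↑-onto x∈ = punchOut (≢-sym (x∈p-y⇒x≢y x∈)) , punchIn-punchOut _

    closed : ∀ {x y} → Adj (deleteVertex v E) x y → y ∈ ⊤ - v
    closed (e , e∈ , _ , y∈e) = ≢⇒∈ λ { refl → proj₂ (∈-deleteVertex⁻ E e∈) y∈e }

    d : Fin n → Fin n → ℕ
    d i j = D (↑ i) (↑ j)

    isMetric : IsMetric _≡_ d
    isMetric = record
      { isSemiMetric = record
        { isQuasiSemiMetric = record
          { isPreMetric = record
            { isProtoMetric = record
              { isPartialOrder  = ≤-isPartialOrder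
              ; ≈-isEquivalence = isEquivalence
              ; cong            = cong₂ d
              ; nonNegative     = z≤n
              }
            ; ≈⇒0 = λ { {i} refl → D-self (↑∈ i) }
            }
          ; 0⇒≈ = λ d≡0 → punchIn-injective v _ _ (D≡0⇒≡ (↑∈ _) (↑∈ _) d≡0)
          }
        ; sym = λ i j → D-sym (↑∈ i) (↑∈ j)
        }
      ; triangle = λ i j k → D-triangle (↑∈ i) (↑∈ j) (↑∈ k)
      }

    step-toward : ∀ {i j k} → d i j ≡ suc k → ∃[ l ] d i l ≡ 1 × d l j ≡ k
    step-toward {i} {j} d≡1+k with D-step closed (↑∈ i) (↑∈ j) d≡1+k
    ... | z , z∈ , _ , iz , zj with ↑-onto z∈
    ...   | l , refl = l , iz , zj

    edge-in-triangle : ∀ {i j} → d i j ≡ 1 → ∃[ l ] l ≢ i × l ≢ j × d i l ≡ 1 × d j l ≡ 1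
    edge-in-triangle {i} {j} d≡1 with D≡1⇒adj (↑∈ i) (↑∈ j) d≡1
    ... | e , e∈ , i∈e , j∈e with ∈-deleteVertex⁻ E e∈
    ...   | e∈E , v∉e with third-vertex (All.lookup uniform e∈E) (↑ i) (↑ j)
    ...     | t , t∈e , t≢i , t≢j with ↑-onto {t} (≢⇒∈ λ { refl → v∉e t∈e })
    ...       | l , refl =
      l , (λ { refl → t≢i refl }) , (λ { refl → t≢j refl }) ,
      adj⇒D≡1 (↑∈ i) (↑∈ l) (e , e∈ , i∈e , t∈e) (≢-sym t≢i) ,
      adj⇒D≡1 (↑∈ j) (↑∈ l) (e , e∈ , j∈e , t∈e) (≢-sym t≢j)

  deletionMetric : TriangulatedPathMetric n
  deletionMetric = record
    { dist = d ; isMetric = isMetric ; step-toward = step-toward ; edge-in-triangle = edge-in-triangle }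

-- Distance layers in a triangulated path metric

-- Sizes p, q of consecutive distance layers around a vertex: if the outer one is nonempty, the edge
-- joining one of its vertices to the inner layer puts a third vertex into one of the two.
Layered : ℕ → ℕ → Set
Layered p q = 1 ≤ q → (2 ≤ p × 1 ≤ q) ⊎ (1 ≤ p × 2 ≤ q)

module Layers {n} (M : TriangulatedPathMetric n) where

  open TriangulatedPathMetric M

  layer : ℕ → Fin n → ℕ
  layer k x = count (λ y → dist x y ≟ k)

  dist-self : dist x x ≡ 0
  dist-self = ≡⇒dist≡0 refl

  ≢⇒0<dist : x ≢ y → 0 < dist x y
  ≢⇒0<dist x≢y = n≢0⇒n>0 (x≢y ∘ dist≡0⇒≡)

  ≤-via : ∀ y → dist x y ≡ a → dist y z ≡ b → dist x z ≤ a + b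
  ≤-via {x} {z = z} y refl refl = dist-triangle x y z

  ≤-suc-via : dist y z ≡ 1 → dist x z ≤ suc (dist x y)
  ≤-suc-via {y} {z} {x} yz = subst (dist x z ≤_) (+-comm (dist x y) 1) (≤-via y refl yz)

  step-from : dist x y ≡ suc k → ∃[ z ] dist y z ≡ 1 × dist x z ≡ k
  step-from {x} {y} x~y with step-toward (trans (dist-sym y x) x~y)
  ... | z , yz , zx = z , yz , trans (dist-sym x z) zx

  layer-≥ : ∀ {ys} → Unique ys → All (λ y → dist x y ≡ k) ys → length ys ≤ layer k x
  layer-≥ {x} {k} = length≤count (λ y → dist x y ≟ k)

  1≤layer : dist x y ≡ k → 1 ≤ layer k x
  1≤layer xy = layer-≥ ([] ∷ []) (xy ∷ [])

  2≤layer : y ≢ z → dist x y ≡ k → dist x z ≡ k → 2 ≤ layer k x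
  2≤layer y≢z xy xz = layer-≥ ((y≢z ∷ []) ∷ [] ∷ []) (xy ∷ xz ∷ [])

  3≤layer : ∀ {v} → x ≢ y → x ≢ z → y ≢ z → dist v x ≡ k → dist v y ≡ k → dist v z ≡ k → 3 ≤ layer k v
  3≤layer x≢y x≢z y≢z vx vy vz =
    layer-≥ ((x≢y ∷ x≢z ∷ []) ∷ (y≢z ∷ []) ∷ [] ∷ []) (vx ∷ vy ∷ vz ∷ [])

  layer-witness : 1 ≤ layer k x → ∃[ y ] dist x y ≡ k
  layer-witness {k} {x} = count-witness (λ y → dist x y ≟ k)

  reach : ∀ m j → dist x y ≡ m → j ≤ m → ∃[ z ] dist x z ≡ j
  reach {y = y} zero j x~y j≤0 = y , trans x~y (sym (n≤0⇒n≡0 j≤0))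
  reach {y = y} (suc m) j x~y j≤ with j ≟ suc m
  ... | yes refl = y , x~y
  ... | no j≢ with step-from x~y
  ...   | z , _ , xz = reach m j xz (≤-pred (≤∧≢⇒< j≤ j≢))

  dist<n : dist x y < n
  dist<n {x} {y} = injective⇒≤ {f = proj₁ ∘ point} injective
    where
    point : (j : Fin (suc (dist x y))) → ∃[ z ] dist x z ≡ toℕ j
    point j = reach (dist x y) (toℕ j) refl (≤-pred (toℕ<n j))
    injective : ∀ {i j} → proj₁ (point i) ≡ proj₁ (point j) → i ≡ j
    injective {i} {j} eq = toℕ-injective (trans (sym (proj₂ (point i))) (trans (cong (dist x) eq) (proj₂ (point j))))

  2≤layer₁ : x ≢ y → 2 ≤ layer 1 x
  2≤layer₁ {x} {y} x≢y with dist x y in x~y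
  ... | zero = contradiction (dist≡0⇒≡ x~y) x≢y
  ... | suc m with step-toward x~y
  ...   | z , xz , _ with edge-in-triangle xz
  ...     | t , _ , t≢z , xt , _ = 2≤layer (≢-sym t≢z) xz xt

  layered : ∀ k x → Layered (layer (suc k) x) (layer (suc (suc k)) x)
  layered k x 1≤outer with layer-witness 1≤outer
  ... | y , xy with step-from xy
  ...   | z , yz , xz with edge-in-triangle yz
  ...     | t , t≢y , t≢z , yt , zt with dist x t ≟ suc k
  ...       | yes xt = inj₁ (2≤layer (≢-sym t≢z) xz xt , 1≤layer xy)
  ...       | no xt≢ = inj₂ (1≤layer xz , 2≤layer (≢-sym t≢y) xy xt)
    where
    xt : dist x t ≡ suc (suc k)
    xt = ≤-antisym (subst (λ m → dist x t ≤ suc m) xz (≤-suc-via zt))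
                   (≤∧≢⇒< (≤-pred (subst (_≤ suc (dist x t)) xy (≤-suc-via (trans (dist-sym t y) yt)))) (≢-sym xt≢))

  -- On seven points the last condition follows from the other two; DeficientVertex needs it.
  Deficient : Fin n → Set
  Deficient x = layer 1 x ≡ 2 × layer 2 x ≡ 1 × 1 ≤ layer 3 x

  deficient? : ∀ x → Dec (Deficient x)
  deficient? x = layer 1 x ≟ 2 ×-dec layer 2 x ≟ 1 ×-dec 1 ≤? layer 3 x

  module DeficientVertex {b} (deficient : Deficient b) where

    private
      layer₁≡2 : layer 1 b ≡ 2
      layer₁≡2 = proj₁ deficient
      layer₂≡1 : layer 2 b ≡ 1
      layer₂≡1 = proj₁ (proj₂ deficient)
      1≤layer₃ : 1 ≤ layer 3 b
      1≤layer₃ = proj₂ (proj₂ deficient)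

    hub : Fin n
    hub = proj₁ (layer-witness (≤-reflexive (sym layer₂≡1)))

    b~hub : dist b hub ≡ 2
    b~hub = proj₂ (layer-witness (≤-reflexive (sym layer₂≡1)))

    hub-unique : dist b z ≡ 2 → z ≡ hub
    hub-unique {z} bz with z Fin.≟ hub
    ... | yes z≡hub = z≡hub
    ... | no z≢hub = contradiction (2≤layer z≢hub bz b~hub) (<⇒≱ (≤-reflexive (cong suc layer₂≡1)))

    out₁ : Fin n
    out₁ = proj₁ (layer-witness 1≤layer₃)

    b~out₁ : dist b out₁ ≡ 3
    b~out₁ = proj₂ (layer-witness 1≤layer₃)

    hub~out₁ : dist hub out₁ ≡ 1
    hub~out₁ with step-from b~out₁
    ... | z , out₁z , bz with hub-unique bz
    ...   | refl = trans (dist-sym hub out₁) out₁z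

    private
      triangle : ∃[ t ] t ≢ hub × t ≢ out₁ × dist hub t ≡ 1 × dist out₁ t ≡ 1
      triangle = edge-in-triangle hub~out₁

    out₂ : Fin n
    out₂ = proj₁ triangle

    out₁≢out₂ : out₁ ≢ out₂
    out₁≢out₂ = ≢-sym (proj₁ (proj₂ (proj₂ triangle)))

    hub~out₂ : dist hub out₂ ≡ 1
    hub~out₂ = proj₁ (proj₂ (proj₂ (proj₂ triangle)))

    b~out₂ : dist b out₂ ≡ 3
    b~out₂ = ≤-antisym (subst (λ m → dist b out₂ ≤ suc m) b~hub (≤-suc-via hub~out₂))
                       (≤∧≢⇒< 2≤b~out₂ (λ 2≡ → out₂≢hub (hub-unique (sym 2≡))))
      where
      out₂≢hub : out₂ ≢ hub
      out₂≢hub = proj₁ (proj₂ triangle)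
      out₁~out₂ : dist out₁ out₂ ≡ 1
      out₁~out₂ = proj₂ (proj₂ (proj₂ (proj₂ triangle)))
      2≤b~out₂ : 2 ≤ dist b out₂
      2≤b~out₂ = ≤-pred (subst (_≤ suc (dist b out₂)) b~out₁ (≤-suc-via (trans (dist-sym out₂ out₁) out₁~out₂)))

    neighbour~hub : dist b y ≡ 1 → dist y hub ≡ 1
    neighbour~hub {y} by with step-toward b~hub
    ... | u , bu , u~hub with edge-in-triangle u~hub
    ...   | u′ , u′≢u , u′≢hub , uu′ , hub~u′ with y Fin.≟ u | y Fin.≟ u′
    ...     | yes refl | _        = u~hub
    ...     | no _     | yes refl = trans (dist-sym u′ hub) hub~u′
    ...     | no y≢u   | no y≢u′  =
      contradiction (3≤layer y≢u y≢u′ (≢-sym u′≢u) by bu bu′) (<⇒≱ (≤-reflexive (cong suc layer₁≡2)))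
      where
      bu′ : dist b u′ ≡ 1
      bu′ = ≤-antisym (≤-pred (≤∧≢⇒< (≤-via u bu uu′) (λ 2≡ → u′≢hub (hub-unique 2≡))))
                      (≤-pred (subst (_≤ suc (dist b u′)) b~hub (≤-suc-via (trans (dist-sym u′ hub) hub~u′))))

  deficient-neighbour-2≤layer₂ : Deficient x → dist x y ≡ 1 → 2 ≤ layer 2 y
  deficient-neighbour-2≤layer₂ {x} {y} deficient xy =
    2≤layer out₁≢out₂ (at-distance-2 b~out₁ hub~out₁) (at-distance-2 b~out₂ hub~out₂)
    where
    open DeficientVertex deficient
    at-distance-2 : ∀ {q} → dist x q ≡ 3 → dist hub q ≡ 1 → dist y q ≡ 2
    at-distance-2 {q} xq hub~q = ≤-antisym (subst (λ m → dist y q ≤ suc m) (neighbour~hub xy) (≤-suc-via hub~q))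
                                           (≤-pred (subst (_≤ suc (dist y q)) xq (≤-via y xy refl)))

  deficient-neighbour-not-deficient : Deficient x → dist x y ≡ 1 → ¬ Deficient y
  deficient-neighbour-not-deficient deficient xy (_ , layer₂≡1 , _) =
    <⇒≱ (≤-reflexive (cong suc layer₂≡1)) (deficient-neighbour-2≤layer₂ deficient xy)

  unique-deficient-neighbour : Deficient y → Deficient z → dist x y ≡ 1 → dist x z ≡ 1 → y ≡ z
  unique-deficient-neighbour {y} {z} {x} deficient-y deficient-z xy xz with y Fin.≟ z
  ... | yes y≡z = y≡z
  ... | no y≢z = contradiction (3≤layer x≢out₁ x≢out₂ out₁≢out₂ hub~x hub~out₁ hub~out₂)
                               (<⇒≱ (≤-reflexive (cong suc layer₁hub≡2)))
    where
    open DeficientVertex deficient-y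
    yx : dist y x ≡ 1
    yx = trans (dist-sym y x) xy
    y~z : dist y z ≡ 2
    y~z = ≤-antisym (≤-via x yx xz)
                    (≤∧≢⇒< (≢⇒0<dist y≢z) (λ 1≡ → deficient-neighbour-not-deficient deficient-y (sym 1≡) deficient-z))
    z≡hub : z ≡ hub
    z≡hub = hub-unique y~z
    hub~x : dist hub x ≡ 1
    hub~x = subst (λ v → dist v x ≡ 1) z≡hub (trans (dist-sym z x) xz)
    layer₁hub≡2 : layer 1 hub ≡ 2
    layer₁hub≡2 = subst (λ v → layer 1 v ≡ 2) z≡hub (proj₁ deficient-z)
    x≢out : ∀ {q} → dist y q ≡ 3 → x ≢ q
    x≢out yq refl = 1+n≢0 {1} (suc-injective (trans (sym yq) yx))
    x≢out₁ : x ≢ out₁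
    x≢out₁ = x≢out b~out₁
    x≢out₂ : x ≢ out₂
    x≢out₂ = x≢out b~out₂

-- Seven points

layered? : ∀ p q → Dec (Layered p q)
layered? p q = 1 ≤? q →-dec ((2 ≤? p ×-dec 1 ≤? q) ⊎-dec (1 ≤? p ×-dec 2 ≤? q))

moment : (ℕ → ℕ) → Vec ℕ 7 → ℕ
moment g ℓ = ∑[ k < 7 ] (g (toℕ k) * lookup ℓ k)

Admissible : Vec ℕ 7 → Set
Admissible (l₀ ∷ l₁ ∷ l₂ ∷ l₃ ∷ l₄ ∷ l₅ ∷ l₆ ∷ []) =
  l₀ ≡ 1 × 2 ≤ l₁ × Layered l₁ l₂ × Layered l₂ l₃ × Layered l₃ l₄ × Layered l₄ l₅ × Layered l₅ l₆

admissible? : ∀ ℓ → Dec (Admissible ℓ)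
admissible? (l₀ ∷ l₁ ∷ l₂ ∷ l₃ ∷ l₄ ∷ l₅ ∷ l₆ ∷ []) =
  l₀ ≟ 1 ×-dec 2 ≤? l₁ ×-dec
  layered? l₁ l₂ ×-dec layered? l₂ l₃ ×-dec layered? l₃ l₄ ×-dec layered? l₄ l₅ ×-dec layered? l₅ l₆

DeficientProfile : Vec ℕ 7 → Set
DeficientProfile (_ ∷ l₁ ∷ l₂ ∷ l₃ ∷ _) = l₁ ≡ 2 × l₂ ≡ 1 × 1 ≤ l₃

deficientProfile? : ∀ ℓ → Dec (DeficientProfile ℓ)
deficientProfile? (_ ∷ l₁ ∷ l₂ ∷ l₃ ∷ _) = l₁ ≟ 2 ×-dec l₂ ≟ 1 ×-dec 1 ≤? l₃

cost budget : Vec ℕ 7 → ℕ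
cost ℓ = 3 * moment id ℓ
budget ℓ = 18 + 5 * moment (λ m → 𝟙 (2 ≤? m)) ℓ

-- Over the seven vertices the budgets add up to the right-hand side of seven-point-bound. A deficient
-- vertex overspends by at most 4, made up by its two neighbours, which have two vertices at distance 2
-- and hence 2 to spare.
Accounting : Vec ℕ 7 → Set
Accounting ℓ@(_ ∷ _ ∷ l₂ ∷ _) =
  (¬ DeficientProfile ℓ → cost ℓ ≤ budget ℓ) ×
  (DeficientProfile ℓ → cost ℓ ≤ 4 + budget ℓ) ×
  (2 ≤ l₂ → 2 + cost ℓ ≤ budget ℓ)

accounting? : ∀ ℓ → Dec (Accounting ℓ)
accounting? ℓ@(_ ∷ _ ∷ l₂ ∷ _) =
  (¬? (deficientProfile? ℓ) →-dec cost ℓ ≤? budget ℓ) ×-dec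
  (deficientProfile? ℓ →-dec cost ℓ ≤? 4 + budget ℓ) ×-dec
  (2 ≤? l₂ →-dec 2 + cost ℓ ≤? budget ℓ)

profile-check : ∀ ℓ → Vec.sum ℓ ≡ 7 → Admissible ℓ → Accounting ℓ
profile-check = all-compositions (toWitness {a? = all? (λ ℓ → admissible? ℓ →-dec accounting? ℓ) (compositions 7 7)} _)

module SevenPoint (M : TriangulatedPathMetric 7) where

  open TriangulatedPathMetric M
  open Layers M

  transmission : Fin 7 → ℕ
  transmission x = ∑[ y < 7 ] dist x y

  far : Fin 7 → ℕ
  far x = count (λ y → 2 ≤? dist x y)

  profile : Fin 7 → Vec ℕ 7
  profile x = tabulate (λ k → layer (toℕ k) x)

  ∑-profile : ∀ g x → ∑[ y < 7 ] g (dist x y) ≡ moment g (profile x)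
  ∑-profile g x = trans (∑-fibres (dist x) g (λ _ → dist<n))
                        (sum-cong-≗ {7} (λ k → cong (g (toℕ k) *_) (sym (lookup∘tabulate (λ k → layer (toℕ k) x) k))))

  profile-sum : ∀ x → Vec.sum (profile x) ≡ 7
  profile-sum x = trans (sum-cong-≗ {7} (λ k → sym (*-identityˡ (layer (toℕ k) x)))) (sym (∑-profile (λ _ → 1) x))

  layer₀≡1 : ∀ x → layer 0 x ≡ 1
  layer₀≡1 x = ≤-antisym (count≤1 (λ y → dist x y ≟ 0) (λ xy xz → trans (sym (dist≡0⇒≡ xy)) (dist≡0⇒≡ xz)))
                         (1≤layer dist-self)

  profile-admissible : ∀ x → Admissible (profile x)
  profile-admissible x = layer₀≡1 x , 2≤layer₁ (≢-sym (punchInᵢ≢i x Fin.zero)) ,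
                         layered 0 x , layered 1 x , layered 2 x , layered 3 x , layered 4 x

  vertex-accounting : ∀ x → Accounting (profile x)
  vertex-accounting x = profile-check (profile x) (profile-sum x) (profile-admissible x)

  cost≡ : ∀ x → cost (profile x) ≡ 3 * transmission x
  cost≡ x = cong (3 *_) (sym (∑-profile id x))

  budget≡ : ∀ x → budget (profile x) ≡ 18 + 5 * far x
  budget≡ x = cong (λ m → 18 + 5 * m) (sym (∑-profile (λ m → 𝟙 (2 ≤? m)) x))

  deficient-neighbour? : ∀ x y → Dec (dist x y ≡ 1 × Deficient y)
  deficient-neighbour? x y = dist x y ≟ 1 ×-dec deficient? y

  deficientNeighbours : Fin 7 → ℕ
  deficientNeighbours x = count (deficient-neighbour? x)

  discharging : ∀ x → 3 * transmission x + 2 * deficientNeighbours x ≤ 18 + 5 * far x + 4 * 𝟙 (deficient? x)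
  discharging x = by-cases (deficient? x)
    where
    open ≤-Reasoning
    normal : ¬ Deficient x → cost (profile x) ≤ budget (profile x)
    normal = proj₁ (vertex-accounting x)
    overspent : Deficient x → cost (profile x) ≤ 4 + budget (profile x)
    overspent = proj₁ (proj₂ (vertex-accounting x))
    crowded : 2 ≤ layer 2 x → 2 + cost (profile x) ≤ budget (profile x)
    crowded = proj₂ (proj₂ (vertex-accounting x))

    no-deficient-neighbours : (∀ y → ¬ (dist x y ≡ 1 × Deficient y)) →
                              3 * transmission x + 2 * deficientNeighbours x ≡ cost (profile x)
    no-deficient-neighbours ∄ = begin-equality
      3 * transmission x + 2 * deficientNeighbours x
        ≡⟨ cong (λ m → 3 * transmission x + 2 * m) (count-none (deficient-neighbour? x) ∄) ⟩
      3 * transmission x + 0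
        ≡⟨ trans (+-identityʳ _) (sym (cost≡ x)) ⟩
      cost (profile x)
        ∎

    by-cases : (d? : Dec (Deficient x)) → 3 * transmission x + 2 * deficientNeighbours x ≤ 18 + 5 * far x + 4 * 𝟙 d?
    by-cases (yes deficient) = begin
      3 * transmission x + 2 * deficientNeighbours x
        ≡⟨ no-deficient-neighbours (λ y (xy , dy) → deficient-neighbour-not-deficient deficient xy dy) ⟩
      cost (profile x)
        ≤⟨ overspent deficient ⟩
      4 + budget (profile x)
        ≡⟨ trans (+-comm 4 _) (cong (_+ 4) (budget≡ x)) ⟩
      18 + 5 * far x + 4
        ∎
    by-cases (no ¬deficient) with any? (deficient-neighbour? x)
    ... | yes (y , xy , deficient-y) = begin
      3 * transmission x + 2 * deficientNeighbours x
        ≤⟨ +-monoʳ-≤ (3 * transmission x) (*-monoʳ-≤ 2 at-most-one) ⟩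
      3 * transmission x + 2
        ≡⟨ trans (+-comm _ 2) (cong (2 +_) (sym (cost≡ x))) ⟩
      2 + cost (profile x)
        ≤⟨ crowded (deficient-neighbour-2≤layer₂ deficient-y (trans (dist-sym y x) xy)) ⟩
      budget (profile x)
        ≡⟨ trans (budget≡ x) (sym (+-identityʳ _)) ⟩
      18 + 5 * far x + 0
        ∎
      where
      at-most-one : deficientNeighbours x ≤ 1
      at-most-one = count≤1 (deficient-neighbour? x) (λ (xy , dy) (xz , dz) → unique-deficient-neighbour dy dz xy xz)
    ... | no ∄ = begin
      3 * transmission x + 2 * deficientNeighbours x
        ≡⟨ no-deficient-neighbours (λ y p → ∄ (y , p)) ⟩
      cost (profile x)
        ≤⟨ normal ¬deficient ⟩
      budget (profile x)
        ≡⟨ trans (budget≡ x) (sym (+-identityʳ _)) ⟩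
      18 + 5 * far x + 0
        ∎

  ∑-deficientNeighbours : ∑[ x < 7 ] deficientNeighbours x ≡ 2 * ∑[ y < 7 ] 𝟙 (deficient? y)
  ∑-deficientNeighbours = begin
    ∑[ x < 7 ] ∑[ y < 7 ] 𝟙 (deficient-neighbour? x y)
      ≡⟨ ∑-comm {7} {7} (λ x y → 𝟙 (deficient-neighbour? x y)) ⟩
    ∑[ y < 7 ] ∑[ x < 7 ] 𝟙 (deficient-neighbour? x y)
      ≡⟨ sum-cong-≗ {7} (λ y → sum-cong-≗ {7} (λ x → split x y)) ⟩
    ∑[ y < 7 ] ∑[ x < 7 ] (𝟙 (dist y x ≟ 1) * 𝟙 (deficient? y))
      ≡⟨ sum-cong-≗ {7} (λ y → *-distribʳ-sum {7} (𝟙 (deficient? y)) (λ x → 𝟙 (dist y x ≟ 1))) ⟨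
    ∑[ y < 7 ] (layer 1 y * 𝟙 (deficient? y))
      ≡⟨ sum-cong-≗ {7} (λ y → two-neighbours (deficient? y)) ⟩
    ∑[ y < 7 ] (2 * 𝟙 (deficient? y))
      ≡⟨ *-distribˡ-sum {7} 2 (λ y → 𝟙 (deficient? y)) ⟨
    2 * ∑[ y < 7 ] 𝟙 (deficient? y)
      ∎
    where
    open ≡-Reasoning
    split : ∀ x y → 𝟙 (deficient-neighbour? x y) ≡ 𝟙 (dist y x ≟ 1) * 𝟙 (deficient? y)
    split x y = trans (𝟙-× (dist x y ≟ 1) (deficient? y)) (cong (λ m → 𝟙 (m ≟ 1) * 𝟙 (deficient? y)) (dist-sym x y))
    two-neighbours : ∀ {y} (d? : Dec (Deficient y)) → layer 1 y * 𝟙 d? ≡ 2 * 𝟙 d?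
    two-neighbours (yes (layer₁≡2 , _)) = cong (_* 1) layer₁≡2
    two-neighbours {y} (no _) = *-zeroʳ (layer 1 y)

  seven-point-bound : 3 * ∑[ x < 7 ] transmission x ≤ 126 + 5 * ∑[ x < 7 ] far x
  seven-point-bound = +-cancelʳ-≤ (4 * δ) (3 * σ) (126 + 5 * φ) (begin
    3 * σ + 4 * δ
      ≡⟨ cong (3 * σ +_) (trans (*-assoc 2 2 δ) (cong (2 *_) (sym ∑-deficientNeighbours))) ⟩
    3 * σ + 2 * ∑[ x < 7 ] deficientNeighbours x
      ≡⟨ cong (_+ 2 * ∑[ x < 7 ] deficientNeighbours x) (*-distribˡ-sum {7} 3 transmission) ⟩
    ∑[ x < 7 ] (3 * transmission x) + 2 * ∑[ x < 7 ] deficientNeighbours x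
      ≡⟨ ∑-+-* (λ x → 3 * transmission x) deficientNeighbours 2 ⟨
    ∑[ x < 7 ] (3 * transmission x + 2 * deficientNeighbours x)
      ≤⟨ ∑-mono-≤ discharging ⟩
    ∑[ x < 7 ] (18 + 5 * far x + 4 * 𝟙 (deficient? x))
      ≡⟨ ∑-+-* (λ x → 18 + 5 * far x) (λ x → 𝟙 (deficient? x)) 4 ⟩
    ∑[ x < 7 ] (18 + 5 * far x) + 4 * δ
      ≡⟨ cong (_+ 4 * δ) (∑-+-* (λ _ → 18) far 5) ⟩
    126 + 5 * φ + 4 * δ
      ∎)
    where
    open ≤-Reasoning
    σ φ δ : ℕ
    σ = ∑[ x < 7 ] transmission x
    φ = ∑[ x < 7 ] far x
    δ = ∑[ x < 7 ] 𝟙 (deficient? x)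

-- Deleting a vertex

distinctPairs : ℕ → ℕ
distinctPairs n = ∑[ u < n ] ∑[ w < n ] 𝟙 (¬? (u Fin.≟ w))

farPairs : (Fin n → Fin n → ℕ) → ℕ
farPairs {n} D = ∑[ u < n ] ∑[ w < n ] 𝟙 (2 ≤? D u w)

module ConnectedHypergraph {E : List (Subset n)} {D : Fin n → Fin n → ℕ}
                           (isDist : ∀ u w → u ∈ ⊤ → w ∈ ⊤ → IsDist E u w (D u w)) where

  open Distances isDist

  ∑∑D≡2*sumPairs : ∑[ u < n ] ∑[ w < n ] D u w ≡ 2 * sumPairs ⊤ D
  ∑∑D≡2*sumPairs = begin
    ∑[ u < n ] ∑[ w < n ] D u w    ≡⟨ sum-cong-≗ {n} (λ u → sumIn-⊤ (D u)) ⟨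
    ∑[ u < n ] sumIn ⊤ (D u)       ≡⟨ sumIn-⊤ (λ u → sumIn ⊤ (D u)) ⟨
    sumIn ⊤ (λ u → sumIn ⊤ (D u))  ≡⟨ sumIn²≡2*sumPairs ⊤ D (λ _ _ u∈ w∈ → D-sym u∈ w∈) (λ _ u∈ → D-self u∈) ⟩
    2 * sumPairs ⊤ D               ∎
    where open ≡-Reasoning

  distinct+far≤∑∑D : distinctPairs n + farPairs D ≤ ∑[ u < n ] ∑[ w < n ] D u w
  distinct+far≤∑∑D = begin
    distinctPairs n + farPairs D
      ≡⟨ ∑-distrib-+ {n} (λ u → ∑[ w < n ] 𝟙 (¬? (u Fin.≟ w))) (λ u → ∑[ w < n ] 𝟙 (2 ≤? D u w)) ⟨
    ∑[ u < n ] (∑[ w < n ] 𝟙 (¬? (u Fin.≟ w)) + ∑[ w < n ] 𝟙 (2 ≤? D u w))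
      ≡⟨ sum-cong-≗ {n} (λ u → ∑-distrib-+ {n} (λ w → 𝟙 (¬? (u Fin.≟ w))) (λ w → 𝟙 (2 ≤? D u w))) ⟨
    ∑[ u < n ] ∑[ w < n ] (𝟙 (¬? (u Fin.≟ w)) + 𝟙 (2 ≤? D u w))
      ≤⟨ ∑-mono-≤ (λ u → ∑-mono-≤ (λ w → pair-bound (u Fin.≟ w) (2 ≤? D u w))) ⟩
    ∑[ u < n ] ∑[ w < n ] D u w
      ∎
    where
    open ≤-Reasoning
    pair-bound : (u≟w : Dec (u ≡ w)) (far? : Dec (2 ≤ D u w)) → 𝟙 (¬? u≟w) + 𝟙 far? ≤ D u w
    pair-bound (yes refl) (yes 2≤) = contradiction 2≤ (¬2≤D-self ∈⊤)
    pair-bound (yes refl) (no _)   = z≤n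
    pair-bound (no _)     (yes 2≤) = 2≤
    pair-bound (no u≢w)   (no _)   = ≢⇒1≤D ∈⊤ ∈⊤ u≢w

  far<distinct : {x y : Fin n} → x ≢ y → farPairs D < distinctPairs n
  far<distinct {x = x} {y} x≢y with D x y in x~y | ≢⇒1≤D ∈⊤ ∈⊤ x≢y
  ... | suc k | _ with D-step (λ _ → ∈⊤) ∈⊤ ∈⊤ x~y
  ...   | z , _ , _ , x~z , _ = ∑-mono-< (λ u → ∑-mono-≤ (far⇒distinct u)) x (∑-mono-< (far⇒distinct x) z near)
    where
    far⇒distinct : ∀ u w → 𝟙 (2 ≤? D u w) ≤ 𝟙 (¬? (u Fin.≟ w))
    far⇒distinct u w = 𝟙-mono (2 ≤? D u w) (¬? (u Fin.≟ w)) λ { 2≤ refl → ¬2≤D-self ∈⊤ 2≤ }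
    near : 𝟙 (2 ≤? D x z) < 𝟙 (¬? (x Fin.≟ z))
    near rewrite x~z = ≤-reflexive (sym (𝟙-yes (¬? (x Fin.≟ z)) λ { refl → 1+n≢0 (trans (sym x~z) (D-self ∈⊤)) }))

module VertexDeletion {m} {E : List (Subset (suc m))} (uniform : All (λ e → ∣ e ∣ ≡ 3) E)
  {D : Fin (suc m) → Fin (suc m) → ℕ} (isDist : ∀ u w → u ∈ ⊤ → w ∈ ⊤ → IsDist E u w (D u w))
  {Dᵥ : Fin (suc m) → Fin (suc m) → Fin (suc m) → ℕ}
  (isDistᵥ : ∀ v u w → u ∈ ⊤ - v → w ∈ ⊤ - v → IsDist (deleteVertex v E) u w (Dᵥ v u w)) where

  private
    module H = Distances isDist
    module Hᵥ v = Distances (isDistᵥ v)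

  deletedMetric : Fin (suc m) → TriangulatedPathMetric m
  deletedMetric v = deletionMetric uniform v (isDistᵥ v)

  ∑∑-deleted≡2*sumPairs : ∀ v → ∑[ i < m ] ∑[ j < m ] TriangulatedPathMetric.dist (deletedMetric v) i j
                                ≡ 2 * sumPairs (⊤ - v) (Dᵥ v)
  ∑∑-deleted≡2*sumPairs v =
    trans (sym (sumIn-⊤-² v (Dᵥ v)))
          (sumIn²≡2*sumPairs (⊤ - v) (Dᵥ v) (λ u w u∈ w∈ → Hᵥ.D-sym v u∈ w∈) (λ u u∈ → Hᵥ.D-self v u∈))

  Separates : Fin (suc m) → Fin (suc m) → Fin (suc m) → Set
  Separates u w v = u ∈ ⊤ - v × w ∈ ⊤ - v × 2 ≤ Dᵥ v u w

  separates? : ∀ u w v → Dec (Separates u w v)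
  separates? u w v = u ∈? ⊤ - v ×-dec w ∈? ⊤ - v ×-dec 2 ≤? Dᵥ v u w

  count-separators≤ : ∀ u w → count (separates? u w) ≤ 𝟙 (¬? (u Fin.≟ w)) + (m ∸ 2) * 𝟙 (2 ≤? D u w)
  count-separators≤ u w = by-cases u w (u Fin.≟ w) (2 ≤? D u w)
    where
    by-cases : ∀ u w (u≟w : Dec (u ≡ w)) (far? : Dec (2 ≤ D u w)) →
               count (separates? u w) ≤ 𝟙 (¬? u≟w) + (m ∸ 2) * 𝟙 far?
    by-cases u .u (yes refl) _ = ≤-trans (≤-reflexive (count-none (separates? u u) never)) z≤n
      where
      never : ∀ v → ¬ Separates u u v
      never v (u∈ , _ , 2≤) = Hᵥ.¬2≤D-self v u∈ 2≤
    by-cases u w (no u≢w) (yes _) = begin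
      count (separates? u w)                               ≤⟨ count-mono (separates? u w) (¬? ∘ on-uw?) avoids ⟩
      count (¬? ∘ on-uw?)                                  ≡⟨ m+n∸m≡n (count on-uw?) _ ⟨
      count on-uw? + count (¬? ∘ on-uw?) ∸ count on-uw?    ≡⟨ cong (_∸ count on-uw?) (count-complement on-uw?) ⟩
      suc m ∸ count on-uw?                                 ≤⟨ ∸-monoʳ-≤ (suc m) 2≤on-uw ⟩
      m ∸ 1                                                ≤⟨ m∸1≤1+m∸2 m ⟩
      1 + (m ∸ 2)                                          ≡⟨ cong suc (sym (*-identityʳ (m ∸ 2))) ⟩
      1 + (m ∸ 2) * 1                                      ∎
      where
      open ≤-Reasoning
      on-uw? : ∀ v → Dec (v ∈ₗ u ∷ w ∷ [])
      on-uw? v = Any.any? (v Fin.≟_) (u ∷ w ∷ [])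
      2≤on-uw : 2 ≤ count on-uw?
      2≤on-uw = length≤count on-uw? ((u≢w ∷ []) ∷ [] ∷ []) (Any.here refl ∷ Any.there (Any.here refl) ∷ [])
      avoids : ∀ {v} → Separates u w v → ¬ v ∈ₗ u ∷ w ∷ []
      avoids (u∈ , _ , _) (Any.here refl) = x∈p-y⇒x≢y u∈ refl
      avoids (_ , w∈ , _) (Any.there (Any.here refl)) = x∈p-y⇒x≢y w∈ refl
      m∸1≤1+m∸2 : ∀ m → m ∸ 1 ≤ 1 + (m ∸ 2)
      m∸1≤1+m∸2 zero = z≤n
      m∸1≤1+m∸2 (suc k) = m≤n+m∸n k 1
    by-cases u w (no u≢w) (no ¬far) with H.D≡1⇒adj ∈⊤ ∈⊤ (≤-antisym (≤-pred (≰⇒> ¬far)) (H.≢⇒1≤D ∈⊤ ∈⊤ u≢w))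
    ... | e , e∈E , u∈e , w∈e =
      ≤-trans (count≤1 (separates? u w) same-third) (≤-reflexive (cong suc (sym (*-zeroʳ (m ∸ 2)))))
      where
      third : ∀ {v} → Separates u w v → v ∈ e × v ≢ u × v ≢ w
      third {v} (u∈ , w∈ , 2≤) =
        decidable-stable (v ∈? e) e-survives , ≢-sym (x∈p-y⇒x≢y u∈) , ≢-sym (x∈p-y⇒x≢y w∈)
        where
        e-survives : ¬ v ∉ e
        e-survives v∉e = <⇒≱ 2≤ (Hᵥ.adj⇒D≤1 v u∈ w∈ (e , ∈-deleteVertex⁺ E e∈E v∉e , u∈e , w∈e))
      same-third : ∀ {v v′} → Separates u w v → Separates u w v′ → v ≡ v′
      same-third s s′ = third-vertex-unique (All.lookup uniform e∈E) u∈e w∈e u≢w (third s) (third s′)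

  deletedFarPairs : Fin (suc m) → ℕ
  deletedFarPairs v = farPairs (TriangulatedPathMetric.dist (deletedMetric v))

  ∑-deletedFarPairs : ∑[ v < suc m ] deletedFarPairs v ≤ distinctPairs (suc m) + (m ∸ 2) * farPairs D
  ∑-deletedFarPairs = begin
    ∑[ v < suc m ] deletedFarPairs v
      ≡⟨ sum-cong-≗ {suc m} (λ v → sumIn-⊤-² v (far-in v)) ⟨
    ∑[ v < suc m ] sumIn (⊤ - v) (λ u → sumIn (⊤ - v) (far-in v u))
      ≡⟨ sum-cong-≗ {suc m} (λ v → trans (sumIn² (⊤ - v) (far-in v)) (sum-cong-≗ {suc m} (λ u → sum-cong-≗ {suc m} (λ w →
           if-if-𝟙 (u ∈? ⊤ - v) (w ∈? ⊤ - v) (2 ≤? Dᵥ v u w))))) ⟩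
    ∑[ v < suc m ] ∑[ u < suc m ] ∑[ w < suc m ] 𝟙 (separates? u w v)
      ≡⟨ ∑-comm {suc m} {suc m} (λ v u → ∑[ w < suc m ] 𝟙 (separates? u w v)) ⟩
    ∑[ u < suc m ] ∑[ v < suc m ] ∑[ w < suc m ] 𝟙 (separates? u w v)
      ≡⟨ sum-cong-≗ {suc m} (λ u → ∑-comm {suc m} {suc m} (λ v w → 𝟙 (separates? u w v))) ⟩
    ∑[ u < suc m ] ∑[ w < suc m ] count (separates? u w)
      ≤⟨ ∑-mono-≤ (λ u → ∑-mono-≤ (count-separators≤ u)) ⟩
    ∑[ u < suc m ] ∑[ w < suc m ] (𝟙 (¬? (u Fin.≟ w)) + (m ∸ 2) * 𝟙 (2 ≤? D u w))
      ≡⟨ sum-cong-≗ {suc m} (λ u → ∑-+-* (λ w → 𝟙 (¬? (u Fin.≟ w))) (λ w → 𝟙 (2 ≤? D u w)) (m ∸ 2)) ⟩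
    ∑[ u < suc m ] (∑[ w < suc m ] 𝟙 (¬? (u Fin.≟ w)) + (m ∸ 2) * ∑[ w < suc m ] 𝟙 (2 ≤? D u w))
      ≡⟨ ∑-+-* (λ u → ∑[ w < suc m ] 𝟙 (¬? (u Fin.≟ w))) (λ u → ∑[ w < suc m ] 𝟙 (2 ≤? D u w)) (m ∸ 2) ⟩
    distinctPairs (suc m) + (m ∸ 2) * farPairs D
      ∎
    where
    open ≤-Reasoning
    far-in : Fin (suc m) → Fin (suc m) → Fin (suc m) → ℕ
    far-in v u w = 𝟙 (2 ≤? Dᵥ v u w)
    if-if-𝟙 : {C : Set} (a? : Dec A) (b? : Dec B) (c? : Dec C) →
              (if does a? then (if does b? then 𝟙 c? else 0) else 0) ≡ 𝟙 (a? ×-dec b? ×-dec c?)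
    if-if-𝟙 (yes _) (yes _) _ = refl
    if-if-𝟙 (yes _) (no _)  _ = refl
    if-if-𝟙 (no _)  _       _ = refl

wiener-arithmetic : ∀ {W A} → 56 + A ≤ 2 * W → 8 * (3 * (2 * W)) ≤ 8 * 126 + 5 * (56 + 5 * A) → 56 ≤ A
wiener-arithmetic {W} {A} lower upper = +-cancelˡ-≤ 1288 56 A (+-cancelʳ-≤ (24 * A) (1288 + 56) (1288 + A) (begin
  1288 + 56 + 24 * A          ≡⟨ *-distribˡ-+ 24 56 A ⟨
  24 * (56 + A)               ≤⟨ *-monoʳ-≤ 24 lower ⟩
  24 * (2 * W)                ≡⟨ *-assoc 8 3 (2 * W) ⟩
  8 * (3 * (2 * W))           ≤⟨ upper ⟩
  8 * 126 + 5 * (56 + 5 * A)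
    ≡⟨ solve 1 (λ a → con 1008 :+ con 5 :* (con 56 :+ con 5 :* a) := con 1288 :+ a :+ con 24 :* a) refl A ⟩
  1288 + A + 24 * A           ∎))
  where
  open ≤-Reasoning
  open +-*-Solver

mainTheorem5 : (E : List (Subset 8)) → Uniform 3 E → ¬ Soltes E
mainTheorem5 E (_ , uniform) (W , (D , isDist , W≡) , deleted) =
  <⇒≱ (far<distinct {x = Fin.zero} {y = Fin.suc Fin.zero} λ ()) (wiener-arithmetic {W} lower upper)
  where
  open ConnectedHypergraph isDist
  open VertexDeletion uniform isDist (λ v → proj₁ (proj₂ (deleted v)))

  lower : 56 + farPairs D ≤ 2 * W
  lower = subst (56 + farPairs D ≤_) (trans ∑∑D≡2*sumPairs (cong (2 *_) (sym W≡))) distinct+far≤∑∑D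

  per-vertex : ∀ v → 3 * (2 * W) ≤ 126 + 5 * deletedFarPairs v
  per-vertex v = subst (λ t → 3 * t ≤ 126 + 5 * deletedFarPairs v)
                       (trans (∑∑-deleted≡2*sumPairs v) (cong (2 *_) (sym (proj₂ (proj₂ (deleted v))))))
                       (SevenPoint.seven-point-bound (deletedMetric v))

  upper : 8 * (3 * (2 * W)) ≤ 8 * 126 + 5 * (56 + 5 * farPairs D)
  upper = begin
    8 * (3 * (2 * W))                             ≡⟨ ∑-const {8} (3 * (2 * W)) ⟨
    ∑[ v < 8 ] (3 * (2 * W))                      ≤⟨ ∑-mono-≤ per-vertex ⟩
    ∑[ v < 8 ] (126 + 5 * deletedFarPairs v)      ≡⟨ ∑-+-* (λ _ → 126) deletedFarPairs 5 ⟩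
    8 * 126 + 5 * ∑[ v < 8 ] deletedFarPairs v    ≤⟨ +-monoʳ-≤ (8 * 126) (*-monoʳ-≤ 5 ∑-deletedFarPairs) ⟩
    8 * 126 + 5 * (56 + 5 * farPairs D)           ∎
    where open ≤-Reasoning
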